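{- Let $T$ be a tree. Then $T$ has a unique minimum edge-vertex dominating set if and only if $T$ has a unique minimum paired-dominating set. (That is, the class of trees having unique minimum edge-vertex dominating sets coincides with the class of trees having unique minimum paired-dominating sets.)
   Context: All graphs are finite and simple. For a graph $G=(V_G,E_G)$, a set $D\subseteq V_G$ is dominating if every vertex of $V_G\setminus D$ has a neighbour in $D$. A set $D\subseteq V_G$ is a paired-dominating set if it is dominating and the induced subgraph $G[D]$ has a perfect matching; a minimum paired-dominating set is one of minimum cardinality. An edge $e$ ev-dominates a vertex $v$ if $e$ is incident to $v$ or $e$ is incident to a vertex adjacent to $v$. A set $M\subseteq E_G$ is an edge-vertex dominating set if every vertex of $G$ is ev-dominated by some edge of $M$; a minimum edge-vertex dominating set is one of minimum cardinality. -}

module Defs where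

open import Data.Nat using (ℕ; _≤_)
open import Data.Fin using (Fin)
open import Data.Fin.Subset using (Subset; _∈_; _∉_; ∣_∣)
open import Data.List using (List; []; _∷_; _++_; [_]; length)
open import Data.List.Relation.Unary.Unique.Propositional using (Unique)
open import Data.Product using (Σ; ∃; _×_; _,_)
open import Data.Sum using (_⊎_)
open import Data.Unit using (⊤)
open import Relation.Binary.PropositionalEquality using (_≡_; _≢_)
open import Relation.Nullary using (¬_)

record Graph : Set where
  field
    n m     : ℕ
    src tgt : Fin m → Fin n
    loopless : ∀ e → src e ≢ tgt e
    simple  : ∀ e f →
      ((src e ≡ src f) × (tgt e ≡ tgt f)) ⊎ ((src e ≡ tgt f) × (tgt e ≡ src f)) →
      e ≡ f

module _ (G : Graph) where
  open Graph G

  Incident : Fin m → Fin n → Set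
  Incident e v = (src e ≡ v) ⊎ (tgt e ≡ v)

  Adj : Fin n → Fin n → Set
  Adj u v = ∃ λ e → ((src e ≡ u) × (tgt e ≡ v)) ⊎ ((src e ≡ v) × (tgt e ≡ u))

  data Walk : Fin n → Fin n → Set where
    here : ∀ {u} → Walk u u
    step : ∀ {u w v} → Adj u w → Walk w v → Walk u v

  Connected : Set
  Connected = ∀ u v → Walk u v

  Chain : List (Fin n) → Set
  Chain []           = ⊤
  Chain (x ∷ [])     = ⊤
  Chain (x ∷ y ∷ r)  = Adj x y × Chain (y ∷ r)

  Cycle : Set
  Cycle = Σ (Fin n) λ x → Σ (List (Fin n)) λ ys →
            (2 ≤ length ys) × Unique (x ∷ ys) × Chain (x ∷ ys ++ [ x ])

  Acyclic : Set
  Acyclic = ¬ Cycle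

  IsTree : Set
  IsTree = (1 ≤ n) × Connected × Acyclic

  Dominating : Subset n → Set
  Dominating D = ∀ v → v ∉ D → ∃ λ u → (u ∈ D) × Adj u v

  PerfectMatchingOf : Subset n → Subset m → Set
  PerfectMatchingOf D M =
    (∀ e → e ∈ M → (src e ∈ D) × (tgt e ∈ D)) ×
    (∀ v → v ∈ D → ∃ λ e → (e ∈ M) × Incident e v) ×
    (∀ v e f → e ∈ M → f ∈ M → Incident e v → Incident f v → e ≡ f)

  HasPerfectMatching : Subset n → Set
  HasPerfectMatching D = ∃ λ M → PerfectMatchingOf D M

  PairedDominating : Subset n → Set
  PairedDominating D = Dominating D × HasPerfectMatching D

  MinPairedDominating : Subset n → Set
  MinPairedDominating D =
    PairedDominating D × (∀ D' → PairedDominating D' → ∣ D ∣ ≤ ∣ D' ∣)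

  UniqueMinPairedDominating : Set
  UniqueMinPairedDominating =
    ∃ λ D → MinPairedDominating D × (∀ D' → MinPairedDominating D' → D' ≡ D)

  EVDominates : Fin m → Fin n → Set
  EVDominates e v = Incident e v ⊎ (∃ λ u → Incident e u × Adj u v)

  EdgeVertexDominating : Subset m → Set
  EdgeVertexDominating M = ∀ v → ∃ λ e → (e ∈ M) × EVDominates e v

  MinEdgeVertexDominating : Subset m → Set
  MinEdgeVertexDominating M =
    EdgeVertexDominating M × (∀ M' → EdgeVertexDominating M' → ∣ M ∣ ≤ ∣ M' ∣)

  UniqueMinEdgeVertexDominating : Set
  UniqueMinEdgeVertexDominating =
    ∃ λ M → MinEdgeVertexDominating M × (∀ M' → MinEdgeVertexDominating M' → M' ≡ M)

-- For a matching M let V(M) be the set of vertices it covers; then |V(M)| = 2|M|, V(M) is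
-- paired-dominating iff M is edge-vertex dominating, and every paired-dominating set D with
-- perfect matching M has D = V(M).  Any edge-vertex dominating set can be repaired into an
-- edge-vertex dominating matching that is no larger and still contains a prescribed
-- sub-matching: while edges g = ts and h share t, either g is redundant, or some neighbour x
-- of s is uncovered and g may be exchanged for sx.  So minimum edge-vertex dominating
-- matchings and minimum paired-dominating sets correspond via M ↦ V(M).  In a forest a
-- matching is determined by V(M), since two matchings with the same cover would yield an
-- alternating cycle; this transfers uniqueness in both directions.

module Submission where

open import Defs
open import Function.Bundles using (_⇔_; mk⇔)

open import Data.Empty using (⊥-elim)
open import Data.Fin using (Fin; zero; suc; toℕ)
open import Data.Fin.Properties using (any?; pigeonhole; toℕ<n) renaming (_≟_ to _≟ᶠ_)
open import Data.Fin.Subset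
open import Data.Fin.Subset.Properties
open import Data.List using (_++_; [_]; applyUpTo; length)
open import Data.List.Relation.Unary.Unique.Propositional.Properties using (applyUpTo⁺₁)
open import Data.Nat using (ℕ; zero; suc; _+_; _*_; _∸_; _≤_; _<_; z≤n; s≤s; s≤s⁻¹)
open import Data.Nat.Induction using (<-wellFounded)
open import Data.Nat.Properties
open import Data.Product using (∃; ∃₂; _×_; _,_; proj₁; proj₂)
open import Data.Product.Relation.Binary.Lex.Strict using (×-Lex; ×-wellFounded)
open import Data.Sum using (_⊎_; inj₁; inj₂)
open import Data.Unit using (tt)
open import Data.Vec using (_∷_; here; there; tabulate)
open import Data.Vec.Properties using (lookup⇒[]=; []=⇒lookup; lookup∘tabulate)
open import Function using (_∘_; _on_)
open import Induction.WellFounded using (WellFounded; Acc; acc)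
open import Relation.Binary.Construct.On as On using ()
open import Relation.Binary.Definitions using (DecidableEquality)
open import Relation.Binary.PropositionalEquality
  using (_≡_; _≢_; refl; sym; trans; cong; subst; module ≡-Reasoning)
open import Relation.Nullary using (¬_; Dec; yes; no; does)
open import Relation.Nullary.Decidable using (_×-dec_; _⊎-dec_; ¬?; dec-true)
open import Relation.Unary using (Pred; Decidable)

x∈p⇒1+∣p-x∣≡∣p∣ : ∀ {k} {x : Fin k} {p : Subset k} → x ∈ p → suc ∣ p - x ∣ ≡ ∣ p ∣
x∈p⇒1+∣p-x∣≡∣p∣ {p = inside  ∷ p} here        = cong (suc ∘ ∣_∣) (p─⊥≡p p)
x∈p⇒1+∣p-x∣≡∣p∣ {p = inside  ∷ p} (there x∈p) = cong suc (x∈p⇒1+∣p-x∣≡∣p∣ x∈p)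
x∈p⇒1+∣p-x∣≡∣p∣ {p = outside ∷ p} (there x∈p) = x∈p⇒1+∣p-x∣≡∣p∣ x∈p

x∉p⇒∣p∪⁅x⁆∣≡1+∣p∣ : ∀ {k} {x : Fin k} {p : Subset k} → x ∉ p → ∣ p ∪ ⁅ x ⁆ ∣ ≡ suc ∣ p ∣
x∉p⇒∣p∪⁅x⁆∣≡1+∣p∣ {x = zero}  {inside  ∷ p} x∉p = ⊥-elim (x∉p here)
x∉p⇒∣p∪⁅x⁆∣≡1+∣p∣ {x = zero}  {outside ∷ p} x∉p = cong (suc ∘ ∣_∣) (∪-identityʳ p)
x∉p⇒∣p∪⁅x⁆∣≡1+∣p∣ {x = suc x} {inside  ∷ p} x∉p = cong suc (x∉p⇒∣p∪⁅x⁆∣≡1+∣p∣ (x∉p ∘ there))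
x∉p⇒∣p∪⁅x⁆∣≡1+∣p∣ {x = suc x} {outside ∷ p} x∉p = x∉p⇒∣p∪⁅x⁆∣≡1+∣p∣ (x∉p ∘ there)

∣p∣≡0⇒x∉p : ∀ {k} {x : Fin k} {p : Subset k} → ∣ p ∣ ≡ 0 → x ∉ p
∣p∣≡0⇒x∉p {x = x} {p} ∣p∣≡0 x∈p = n≮0 (subst (∣ p - x ∣ <_) ∣p∣≡0 (x∈p⇒∣p-x∣<∣p∣ x∈p))

x∈p-y⇒x≢y : ∀ {k} {x y : Fin k} (p : Subset k) → x ∈ p - y → x ≢ y
x∈p-y⇒x≢y {x = zero}  (_ ∷ p) ()           refl
x∈p-y⇒x≢y {x = suc x} (_ ∷ p) (there x∈p-y) refl = x∈p-y⇒x≢y p x∈p-y refl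

p⊆q∧x∉p⇒p⊆q-x : ∀ {k} {x : Fin k} {p q : Subset k} → p ⊆ q → x ∉ p → p ⊆ q - x
p⊆q∧x∉p⇒p⊆q-x p⊆q x∉p y∈p = x∈p∧x≢y⇒x∈p-y (p⊆q y∈p) λ { refl → x∉p y∈p }

x∈p⇒⁅x⁆⊆p : ∀ {k} {x : Fin k} {p : Subset k} → x ∈ p → ⁅ x ⁆ ⊆ p
x∈p⇒⁅x⁆⊆p {p = p} x∈p y∈⁅x⁆ = subst (_∈ p) (sym (x∈⁅y⁆⇒x≡y _ y∈⁅x⁆)) x∈p

module _ {k ℓ} {P : Pred (Fin k) ℓ} (P? : Decidable P) where

  ∈-tabulate⁺ : ∀ {x} → P x → x ∈ tabulate (does ∘ P?)
  ∈-tabulate⁺ {x} px = lookup⇒[]= x _ (trans (lookup∘tabulate _ x) (dec-true (P? x) px))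

  ∈-tabulate⁻ : ∀ {x} → x ∈ tabulate (does ∘ P?) → P x
  ∈-tabulate⁻ {x} x∈ with P? x | trans (sym (lookup∘tabulate _ x)) ([]=⇒lookup x∈)
  ... | yes px | _ = px

module _ {A : Set} where

  InjectiveUpTo : (ℕ → A) → ℕ → Set
  InjectiveUpTo f j = ∀ {p q} → p < q → q ≤ j → f p ≢ f q

  SimpleLoop : (ℕ → A) → ℕ → Set
  SimpleLoop g l = g (suc l) ≡ g 0 × (∀ {i j} → i < j → j < suc l → g i ≢ g j)

  injectiveUpTo⊎simpleLoop : DecidableEquality A → ∀ f j →
    InjectiveUpTo f j ⊎ ∃₂ λ a l → SimpleLoop (λ i → f (i + a)) l
  injectiveUpTo⊎simpleLoop _≟_ f zero = inj₁ λ p<q q≤0 _ → n≮0 (<-≤-trans p<q q≤0)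
  injectiveUpTo⊎simpleLoop _≟_ f (suc j) with injectiveUpTo⊎simpleLoop _≟_ f j
  ... | inj₂ loop = inj₂ loop
  ... | inj₁ inj with anyUpTo? (λ a → f a ≟ f (suc j)) (suc j)
  ...   | no ¬repeat = inj₁ injective
    where
    injective : InjectiveUpTo f (suc j)
    injective p<q q≤1+j with m≤n⇒m<n∨m≡n q≤1+j
    ... | inj₁ q<1+j = inj p<q (s≤s⁻¹ q<1+j)
    ... | inj₂ refl  = λ fp≡fq → ¬repeat (_ , p<q , fp≡fq)
  ...   | yes (a , a<1+j , fa≡f1+j) = inj₂ (a , j ∸ a , closes , injective)
    where
    l+a≡j : j ∸ a + a ≡ j
    l+a≡j = m∸n+n≡m (s≤s⁻¹ a<1+j)
    closes : f (suc (j ∸ a + a)) ≡ f a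
    closes = trans (cong (f ∘ suc) l+a≡j) (sym fa≡f1+j)
    injective : ∀ {i i′} → i < i′ → i′ < suc (j ∸ a) → f (i + a) ≢ f (i′ + a)
    injective i<i′ i′≤l = inj (+-monoˡ-< a i<i′) (subst (_ ≤_) l+a≡j (+-monoˡ-≤ a (s≤s⁻¹ i′≤l)))

simpleLoop : ∀ {k} (f : ℕ → Fin k) → ∃₂ λ a l → SimpleLoop (λ i → f (i + a)) l
simpleLoop {k} f with injectiveUpTo⊎simpleLoop _≟ᶠ_ f k
... | inj₂ loop = loop
... | inj₁ inj with pigeonhole (n<1+n k) (f ∘ toℕ)
...   | i , j , i<j , fi≡fj = ⊥-elim (inj i<j (s≤s⁻¹ (toℕ<n j)) fi≡fj)

module _ (G : Graph) where
  open Graph G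

  Joins : Fin m → Fin n → Fin n → Set
  Joins e a b = ((src e ≡ a) × (tgt e ≡ b)) ⊎ ((src e ≡ b) × (tgt e ≡ a))

  joins-sym : ∀ {e a b} → Joins e a b → Joins e b a
  joins-sym (inj₁ ends) = inj₂ ends
  joins-sym (inj₂ ends) = inj₁ ends

  joins⇒incidentˡ : ∀ {e a b} → Joins e a b → Incident G e a
  joins⇒incidentˡ (inj₁ (src≡a , _)) = inj₁ src≡a
  joins⇒incidentˡ (inj₂ (_ , tgt≡a)) = inj₂ tgt≡a

  joins⇒incidentʳ : ∀ {e a b} → Joins e a b → Incident G e b
  joins⇒incidentʳ = joins⇒incidentˡ ∘ joins-sym

  incident⇒joins : ∀ {e a} → Incident G e a → ∃ λ b → Joins e a b
  incident⇒joins (inj₁ src≡a) = _ , inj₁ (src≡a , refl)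
  incident⇒joins (inj₂ tgt≡a) = _ , inj₂ (refl , tgt≡a)

  incident⇒endpoint : ∀ {e a b x} → Joins e a b → Incident G e x → x ≡ a ⊎ x ≡ b
  incident⇒endpoint (inj₁ (refl , refl)) (inj₁ refl) = inj₁ refl
  incident⇒endpoint (inj₁ (refl , refl)) (inj₂ refl) = inj₂ refl
  incident⇒endpoint (inj₂ (refl , refl)) (inj₁ refl) = inj₂ refl
  incident⇒endpoint (inj₂ (refl , refl)) (inj₂ refl) = inj₁ refl

  joins-injective : ∀ {e f a b} → Joins e a b → Joins f a b → e ≡ f
  joins-injective (inj₁ (refl , refl)) (inj₁ (p , q)) = simple _ _ (inj₁ (sym p , sym q))
  joins-injective (inj₁ (refl , refl)) (inj₂ (p , q)) = simple _ _ (inj₂ (sym q , sym p))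
  joins-injective (inj₂ (refl , refl)) (inj₁ (p , q)) = simple _ _ (inj₂ (sym q , sym p))
  joins-injective (inj₂ (refl , refl)) (inj₂ (p , q)) = simple _ _ (inj₁ (sym p , sym q))

  adj-irrefl : ∀ {a} → ¬ Adj G a a
  adj-irrefl (e , inj₁ (p , q)) = loopless e (trans p (sym q))
  adj-irrefl (e , inj₂ (p , q)) = loopless e (trans p (sym q))

  incident? : ∀ e v → Dec (Incident G e v)
  incident? e v = (src e ≟ᶠ v) ⊎-dec (tgt e ≟ᶠ v)

  adj? : ∀ u v → Dec (Adj G u v)
  adj? u v = any? λ e → ((src e ≟ᶠ u) ×-dec (tgt e ≟ᶠ v)) ⊎-dec ((src e ≟ᶠ v) ×-dec (tgt e ≟ᶠ u))

  NonBacktrackingWalk : (ℕ → Fin n) → Set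
  NonBacktrackingWalk f = (∀ k → Adj G (f k) (f (suc k))) × (∀ k → f (suc (suc k)) ≢ f k)

  chain-applyUpTo : ∀ f l → (∀ k → Adj G (f k) (f (suc k))) →
                    Chain G (applyUpTo f (suc l) ++ [ f (suc l) ])
  chain-applyUpTo f zero    adj = adj 0 , tt
  chain-applyUpTo f (suc l) adj = adj 0 , chain-applyUpTo (f ∘ suc) l (adj ∘ suc)

  simpleLoop⇒cycle : ∀ {f} l → NonBacktrackingWalk f → SimpleLoop f l → Cycle G
  simpleLoop⇒cycle {f} l (adj , nb) (closes , injective) =
    f 0 , applyUpTo (f ∘ suc) l , 2≤length l closes , applyUpTo⁺₁ f (suc l) injective ,
    subst (λ x → Chain G (applyUpTo f (suc l) ++ [ x ])) closes (chain-applyUpTo f l adj)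
    where
    2≤length : ∀ k → f (suc k) ≡ f 0 → 2 ≤ length (applyUpTo (f ∘ suc) k)
    2≤length zero          f1≡f0 = ⊥-elim (adj-irrefl (subst (Adj G (f 0)) f1≡f0 (adj 0)))
    2≤length (suc zero)    f2≡f0 = ⊥-elim (nb 0 f2≡f0)
    2≤length (suc (suc k)) _     = s≤s (s≤s z≤n)

  nonBacktrackingWalk⇒cycle : ∀ {f} → NonBacktrackingWalk f → Cycle G
  nonBacktrackingWalk⇒cycle {f} (adj , nb) =
    let a , l , loop = simpleLoop f in
    simpleLoop⇒cycle l ((λ k → adj (k + a)) , (λ k → nb (k + a))) loop

  CoveredBy : Subset m → Fin n → Set
  CoveredBy M v = ∃ λ e → e ∈ M × Incident G e v

  coveredBy? : ∀ M → Decidable (CoveredBy M)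
  coveredBy? M v = any? λ e → (e ∈? M) ×-dec incident? e v

  -- Opaque, so that goals about covered sets are never normalised through the decision procedure.
  opaque
    covered : Subset m → Subset n
    covered M = tabulate (does ∘ coveredBy? M)

    ∈-covered⁺ : ∀ {M e v} → e ∈ M → Incident G e v → v ∈ covered M
    ∈-covered⁺ {M} e∈M e∋v = ∈-tabulate⁺ (coveredBy? M) (_ , e∈M , e∋v)

    ∈-covered⁻ : ∀ {M v} → v ∈ covered M → CoveredBy M v
    ∈-covered⁻ {M} = ∈-tabulate⁻ (coveredBy? M)

  IsMatching : Subset m → Set
  IsMatching M = ∀ v e f → e ∈ M → f ∈ M → Incident G e v → Incident G f v → e ≡ f

  Conflict : Subset m → Set
  Conflict M = ∃ λ v → ∃₂ λ e f → e ∈ M × f ∈ M × Incident G e v × Incident G f v × e ≢ f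

  matching⊎conflict : ∀ M → IsMatching M ⊎ Conflict M
  matching⊎conflict M with any? (λ v → any? λ e → any? λ f →
    (e ∈? M) ×-dec (f ∈? M) ×-dec incident? e v ×-dec incident? f v ×-dec ¬? (e ≟ᶠ f))
  ... | yes conflict = inj₂ conflict
  ... | no ¬conflict = inj₁ matching
    where
    matching : IsMatching M
    matching v e f e∈M f∈M e∋v f∋v with e ≟ᶠ f
    ... | yes e≡f = e≡f
    ... | no  e≢f = ⊥-elim (¬conflict (v , e , f , e∈M , f∈M , e∋v , f∋v , e≢f))

  matching-⊆ : ∀ {M N} → N ⊆ M → IsMatching M → IsMatching N
  matching-⊆ N⊆M matching v e f e∈N f∈N = matching v e f (N⊆M e∈N) (N⊆M f∈N)

  matching-⊥ : IsMatching ⊥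
  matching-⊥ v e f e∈⊥ = ⊥-elim (∉⊥ e∈⊥)

  matching-⁅⁆ : ∀ p → IsMatching ⁅ p ⁆
  matching-⁅⁆ p v e f e∈⁅p⁆ f∈⁅p⁆ _ _ = trans (x∈⁅y⁆⇒x≡y p e∈⁅p⁆) (sym (x∈⁅y⁆⇒x≡y p f∈⁅p⁆))

  covered-remove : ∀ {M g} → g ∈ M → covered M ≡ (covered (M - g) ∪ ⁅ src g ⁆) ∪ ⁅ tgt g ⁆
  covered-remove {M} {g} g∈M = ⊆-antisym ⊆-ends ⊇-ends
    where
    ⊆-ends : covered M ⊆ (covered (M - g) ∪ ⁅ src g ⁆) ∪ ⁅ tgt g ⁆
    ⊆-ends v∈ with ∈-covered⁻ v∈
    ... | k , k∈M , k∋v with k ≟ᶠ g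
    ...   | no k≢g = x∈p∪q⁺ (inj₁ (x∈p∪q⁺ (inj₁ (∈-covered⁺ (x∈p∧x≢y⇒x∈p-y k∈M k≢g) k∋v))))
    ...   | yes refl with k∋v
    ...     | inj₁ refl = x∈p∪q⁺ (inj₁ (x∈p∪q⁺ (inj₂ (x∈⁅x⁆ (src g)))))
    ...     | inj₂ refl = x∈p∪q⁺ (inj₂ (x∈⁅x⁆ (tgt g)))
    ⊇-ends : (covered (M - g) ∪ ⁅ src g ⁆) ∪ ⁅ tgt g ⁆ ⊆ covered M
    ⊇-ends v∈ with x∈p∪q⁻ (covered (M - g) ∪ ⁅ src g ⁆) _ v∈
    ... | inj₂ v∈⁅tgt⁆ = ∈-covered⁺ g∈M (inj₂ (sym (x∈⁅y⁆⇒x≡y _ v∈⁅tgt⁆)))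
    ... | inj₁ v∈′ with x∈p∪q⁻ (covered (M - g)) _ v∈′
    ...   | inj₂ v∈⁅src⁆ = ∈-covered⁺ g∈M (inj₁ (sym (x∈⁅y⁆⇒x≡y _ v∈⁅src⁆)))
    ...   | inj₁ v∈M-g = let k , k∈M-g , k∋v = ∈-covered⁻ v∈M-g in
                         ∈-covered⁺ (p─q⊆p M _ k∈M-g) k∋v

  endpoint∉covered-remove : ∀ {M g v} → IsMatching M → g ∈ M → Incident G g v →
                            v ∉ covered (M - g)
  endpoint∉covered-remove {M} matching g∈M g∋v v∈ =
    let k , k∈M-g , k∋v = ∈-covered⁻ v∈ in
    x∈p-y⇒x≢y M k∈M-g (matching _ _ _ (p─q⊆p M _ k∈M-g) g∈M k∋v g∋v)

  ∣covered∣-remove : ∀ {M g} → IsMatching M → g ∈ M → ∣ covered M ∣ ≡ 2 + ∣ covered (M - g) ∣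
  ∣covered∣-remove {M} {g} matching g∈M = begin
    ∣ covered M ∣                                   ≡⟨ cong ∣_∣ (covered-remove g∈M) ⟩
    ∣ (covered (M - g) ∪ ⁅ src g ⁆) ∪ ⁅ tgt g ⁆ ∣   ≡⟨ x∉p⇒∣p∪⁅x⁆∣≡1+∣p∣ tgt∉ ⟩
    suc ∣ covered (M - g) ∪ ⁅ src g ⁆ ∣             ≡⟨ cong suc (x∉p⇒∣p∪⁅x⁆∣≡1+∣p∣ src∉) ⟩
    2 + ∣ covered (M - g) ∣                         ∎
    where
    open ≡-Reasoning
    src∉ : src g ∉ covered (M - g)
    src∉ = endpoint∉covered-remove matching g∈M (inj₁ refl)
    tgt∉ : tgt g ∉ covered (M - g) ∪ ⁅ src g ⁆
    tgt∉ tgt∈ with x∈p∪q⁻ (covered (M - g)) _ tgt∈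
    ... | inj₁ tgt∈M-g = endpoint∉covered-remove matching g∈M (inj₂ refl) tgt∈M-g
    ... | inj₂ tgt∈⁅src⁆ = loopless g (sym (x∈⁅y⁆⇒x≡y _ tgt∈⁅src⁆))

  ∣covered∣≡2*∣M∣ : ∀ {M} → IsMatching M → ∣ covered M ∣ ≡ 2 * ∣ M ∣
  ∣covered∣≡2*∣M∣ {M} = go ∣ M ∣ refl
    where
    go : ∀ c {M} → ∣ M ∣ ≡ c → IsMatching M → ∣ covered M ∣ ≡ 2 * c
    go zero {M} ∣M∣≡0 _ = trans (cong ∣_∣ (Empty-unique uncovered)) (∣⊥∣≡0 n)
      where
      uncovered : Empty (covered M)
      uncovered (v , v∈) = let e , e∈M , _ = ∈-covered⁻ v∈ in ∣p∣≡0⇒x∉p ∣M∣≡0 e∈M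
    go (suc c) {M} ∣M∣≡1+c matching with nonempty? M
    ... | no ∅ = ⊥-elim (0≢1+n (trans (sym (trans (cong ∣_∣ (Empty-unique ∅)) (∣⊥∣≡0 m))) ∣M∣≡1+c))
    ... | yes (g , g∈M) = begin
      ∣ covered M ∣            ≡⟨ ∣covered∣-remove matching g∈M ⟩
      2 + ∣ covered (M - g) ∣  ≡⟨ cong (2 +_) (go c ∣M-g∣≡c (matching-⊆ (p─q⊆p M _) matching)) ⟩
      2 + 2 * c                ≡⟨ sym (*-suc 2 c) ⟩
      2 * suc c                ∎
      where
      open ≡-Reasoning
      ∣M-g∣≡c : ∣ M - g ∣ ≡ c
      ∣M-g∣≡c = suc-injective (trans (x∈p⇒1+∣p-x∣≡∣p∣ g∈M) ∣M∣≡1+c)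

  Near : Fin n → Fin n → Set
  Near u z = u ≡ z ⊎ Adj G u z

  near⇒evDominates : ∀ {e u z} → Incident G e u → Near u z → EVDominates G e z
  near⇒evDominates e∋u (inj₁ refl) = inj₁ e∋u
  near⇒evDominates e∋u (inj₂ u~z)  = inj₂ (_ , e∋u , u~z)

  evDominates⇒near : ∀ {e a b z} → Joins e a b → EVDominates G e z → Near a z ⊎ Near b z
  evDominates⇒near e-ab (inj₁ e∋z) with incident⇒endpoint e-ab e∋z
  ... | inj₁ refl = inj₁ (inj₁ refl)
  ... | inj₂ refl = inj₂ (inj₁ refl)
  evDominates⇒near e-ab (inj₂ (u , e∋u , u~z)) with incident⇒endpoint e-ab e∋u
  ... | inj₁ refl = inj₁ (inj₂ u~z)
  ... | inj₂ refl = inj₂ (inj₂ u~z)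

  evDominating-replace : ∀ {M M′ g} → EdgeVertexDominating G M → M - g ⊆ M′ →
    (∀ {z} → EVDominates G g z → ∃ λ e → e ∈ M′ × EVDominates G e z) →
    EdgeVertexDominating G M′
  evDominating-replace {g = g} ev M-g⊆M′ replace z with ev z
  ... | e , e∈M , e≻z with e ≟ᶠ g
  ...   | yes refl = replace e≻z
  ...   | no  e≢g  = e , M-g⊆M′ (x∈p∧x≢y⇒x∈p-y e∈M e≢g) , e≻z

  Extension : Subset m → Fin n → Set
  Extension M s = ∃ λ x → Adj G s x × x ∉ covered M

  extension? : ∀ M s → Dec (Extension M s)
  extension? M s = any? λ x → adj? s x ×-dec ¬? (x ∈? covered M)

  -- h ev-dominates every vertex that g dominates near t, so g is only needed near s.
  module Repair {M g h t s} (h∈M : h ∈ M) (h≢g : h ≢ g) (h∋t : Incident G h t)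
                (g-ts : Joins g t s) where

    h∈M-g : h ∈ M - g
    h∈M-g = x∈p∧x≢y⇒x∈p-y h∈M h≢g

    t~s : Adj G t s
    t~s = g , g-ts

    removable : EdgeVertexDominating G M → ¬ Extension M s → EdgeVertexDominating G (M - g)
    removable ev ¬ext = evDominating-replace ev ⊆-refl replace
      where
      replace : ∀ {z} → EVDominates G g z → ∃ λ e → e ∈ M - g × EVDominates G e z
      replace g≻z with evDominates⇒near g-ts g≻z
      ... | inj₁ t≈z        = h , h∈M-g , near⇒evDominates h∋t t≈z
      ... | inj₂ (inj₁ refl) = h , h∈M-g , near⇒evDominates h∋t (inj₂ t~s)
      replace {z} g≻z | inj₂ (inj₂ s~z) with z ∈? covered M
      ... | no z∉ = ⊥-elim (¬ext (z , s~z , z∉))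
      ... | yes z∈ with ∈-covered⁻ z∈
      ...   | k , k∈M , k∋z with k ≟ᶠ g
      ...     | no k≢g = k , x∈p∧x≢y⇒x∈p-y k∈M k≢g , inj₁ k∋z
      ...     | yes refl with incident⇒endpoint g-ts k∋z
      ...       | inj₁ refl = h , h∈M-g , inj₁ h∋t
      ...       | inj₂ refl = ⊥-elim (adj-irrefl s~z)

    module _ {e′} (e′∋s : Incident G e′ s) where

      M′ : Subset m
      M′ = (M - g) ∪ ⁅ e′ ⁆

      h∈M′ : h ∈ M′
      h∈M′ = x∈p∪q⁺ (inj₁ h∈M-g)

      e′∈M′ : e′ ∈ M′
      e′∈M′ = x∈p∪q⁺ {p = M - g} (inj₂ (x∈⁅x⁆ e′))

      swappable : EdgeVertexDominating G M → EdgeVertexDominating G M′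
      swappable ev = evDominating-replace ev (λ e∈ → x∈p∪q⁺ (inj₁ e∈)) replace
        where
        replace : ∀ {z} → EVDominates G g z → ∃ λ e → e ∈ M′ × EVDominates G e z
        replace g≻z with evDominates⇒near g-ts g≻z
        ... | inj₁ t≈z = h  , h∈M′  , near⇒evDominates h∋t t≈z
        ... | inj₂ s≈z = e′ , e′∈M′ , near⇒evDominates e′∋s s≈z

      covered-swap : covered M ⊆ covered M′
      covered-swap v∈ with ∈-covered⁻ v∈
      ... | k , k∈M , k∋v with k ≟ᶠ g
      ...   | no k≢g = ∈-covered⁺ (x∈p∪q⁺ (inj₁ (x∈p∧x≢y⇒x∈p-y k∈M k≢g))) k∋v
      ...   | yes refl with incident⇒endpoint g-ts k∋v
      ...     | inj₁ refl = ∈-covered⁺ h∈M′ h∋t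
      ...     | inj₂ refl = ∈-covered⁺ e′∈M′ e′∋s

  -- A repair step either removes an edge, or keeps the size and covers strictly more vertices.
  size : Subset m → ℕ × ℕ
  size M = ∣ M ∣ , ∣ ∁ (covered M) ∣

  _≺_ : Subset m → Subset m → Set
  _≺_ = ×-Lex _≡_ _<_ _<_ on size

  ≺-wellFounded : WellFounded _≺_
  ≺-wellFounded = On.wellFounded size (×-wellFounded <-wellFounded <-wellFounded)

  M′≺M⇒∣M′∣≤∣M∣ : ∀ {M′ M} → M′ ≺ M → ∣ M′ ∣ ≤ ∣ M ∣
  M′≺M⇒∣M′∣≤∣M∣ (inj₁ ∣M′∣<∣M∣)       = <⇒≤ ∣M′∣<∣M∣
  M′≺M⇒∣M′∣≤∣M∣ (inj₂ (∣M′∣≡∣M∣ , _)) = ≤-reflexive ∣M′∣≡∣M∣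

  conflict⇒removableEdge : ∀ {M P} → IsMatching P → Conflict M →
    ∃₂ λ g h → ∃ λ t → g ∈ M × h ∈ M × h ≢ g × Incident G g t × Incident G h t × g ∉ P
  conflict⇒removableEdge {P = P} matching (t , e , f , e∈M , f∈M , e∋t , f∋t , e≢f) with e ∈? P
  ... | no  e∉P = e , f , t , e∈M , f∈M , e≢f ∘ sym , e∋t , f∋t , e∉P
  ... | yes e∈P = f , e , t , f∈M , e∈M , e≢f , f∋t , e∋t ,
                  λ f∈P → e≢f (matching t e f e∈P f∈P e∋t f∋t)

  conflict⇒≺-evDominating : ∀ {M P} → EdgeVertexDominating G M → Conflict M →
    IsMatching P → P ⊆ M → ∃ λ M′ → EdgeVertexDominating G M′ × M′ ≺ M × P ⊆ M′
  conflict⇒≺-evDominating {M} {P} ev conflict matchingP P⊆M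
    with conflict⇒removableEdge matchingP conflict
  ... | g , h , t , g∈M , h∈M , h≢g , g∋t , h∋t , g∉P with incident⇒joins g∋t
  ... | s , g-ts with extension? M s
  ... | no ¬ext =
    M - g , removable ev ¬ext , inj₁ (x∈p⇒∣p-x∣<∣p∣ g∈M) , p⊆q∧x∉p⇒p⊆q-x P⊆M g∉P
    where open Repair h∈M h≢g h∋t g-ts
  ... | yes (x , (e′ , e′-sx) , x∉) =
    M′ e′∋s , swappable e′∋s ev , inj₂ (∣M′∣≡∣M∣ , ∣∁covered∣<) ,
    x∈p∪q⁺ ∘ inj₁ ∘ p⊆q∧x∉p⇒p⊆q-x P⊆M g∉P
    where
    open Repair h∈M h≢g h∋t g-ts
    e′∋s : Incident G e′ s
    e′∋s = joins⇒incidentˡ e′-sx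
    e′∉M-g : e′ ∉ M - g
    e′∉M-g e′∈ = x∉ (∈-covered⁺ (p─q⊆p M _ e′∈) (joins⇒incidentʳ e′-sx))
    ∣M′∣≡∣M∣ : ∣ M′ e′∋s ∣ ≡ ∣ M ∣
    ∣M′∣≡∣M∣ = trans (x∉p⇒∣p∪⁅x⁆∣≡1+∣p∣ e′∉M-g) (x∈p⇒1+∣p-x∣≡∣p∣ g∈M)
    ∣∁covered∣< : ∣ ∁ (covered (M′ e′∋s)) ∣ < ∣ ∁ (covered M) ∣
    ∣∁covered∣< = p⊂q⇒∣p∣<∣q∣ (p⊂q⇒∁p⊃∁q
      (covered-swap e′∋s , x , ∈-covered⁺ (e′∈M′ e′∋s) (joins⇒incidentʳ e′-sx) , x∉))

  evDominating⇒matching : ∀ {M P} → EdgeVertexDominating G M → IsMatching P → P ⊆ M →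
    ∃ λ N → EdgeVertexDominating G N × IsMatching N × ∣ N ∣ ≤ ∣ M ∣ × P ⊆ N
  evDominating⇒matching {M} {P} ev matchingP = go (≺-wellFounded M) ev
    where
    go : ∀ {M} → Acc _≺_ M → EdgeVertexDominating G M → P ⊆ M →
         ∃ λ N → EdgeVertexDominating G N × IsMatching N × ∣ N ∣ ≤ ∣ M ∣ × P ⊆ N
    go {M} (acc smaller) ev P⊆M with matching⊎conflict M
    ... | inj₁ matching = M , ev , matching , ≤-refl , P⊆M
    ... | inj₂ conflict with conflict⇒≺-evDominating ev conflict matchingP P⊆M
    ...   | M′ , ev′ , M′≺M , P⊆M′ with go (smaller M′≺M) ev′ P⊆M′
    ...     | N , evN , matchingN , ∣N∣≤∣M′∣ , P⊆N =
                N , evN , matchingN , ≤-trans ∣N∣≤∣M′∣ (M′≺M⇒∣M′∣≤∣M∣ M′≺M) , P⊆N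

  record Dart (P Q : Subset m) : Set where
    field
      tail head : Fin n
      edge      : Fin m
      joins     : Joins edge tail head
      ∈P        : edge ∈ P
      ∉Q        : edge ∉ Q

  module _ {P Q} (matchingP : IsMatching P) (P⊆Q : covered P ⊆ covered Q) (d : Dart P Q) where
    open Dart d

    private
      covering : CoveredBy Q head
      covering = ∈-covered⁻ (P⊆Q (∈-covered⁺ ∈P (joins⇒incidentʳ joins)))

      e : Fin m
      e = proj₁ covering

      e∈Q : e ∈ Q
      e∈Q = proj₁ (proj₂ covering)

      e-head : Joins e head (proj₁ (incident⇒joins (proj₂ (proj₂ covering))))
      e-head = proj₂ (incident⇒joins (proj₂ (proj₂ covering)))

      e≢edge : e ≢ edge
      e≢edge e≡edge = ∉Q (subst (_∈ Q) e≡edge e∈Q)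

    nextDart : Dart Q P
    nextDart = record
      { tail = head ; head = _ ; edge = e ; joins = e-head ; ∈P = e∈Q
      ; ∉Q   = λ e∈P → e≢edge (matchingP head e edge e∈P ∈P (joins⇒incidentˡ e-head)
                                 (joins⇒incidentʳ joins))
      }

    nextDart-head≢tail : Dart.head nextDart ≢ tail
    nextDart-head≢tail c≡tail =
      e≢edge (joins-injective (subst (Joins e head) c≡tail e-head) (joins-sym joins))

  alternatingWalk : ∀ {P Q} → IsMatching P → IsMatching Q → covered P ≡ covered Q →
                    Dart P Q → ℕ → Fin n
  alternatingWalk mP mQ P≡Q d zero    = Dart.tail d
  alternatingWalk mP mQ P≡Q d (suc k) =
    alternatingWalk mQ mP (sym P≡Q) (nextDart mP (⊆-reflexive P≡Q) d) k

  alternatingWalk-adjacent : ∀ {P Q} mP mQ P≡Q (d : Dart P Q) k →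
    Adj G (alternatingWalk mP mQ P≡Q d k) (alternatingWalk mP mQ P≡Q d (suc k))
  alternatingWalk-adjacent mP mQ P≡Q d zero    = Dart.edge d , Dart.joins d
  alternatingWalk-adjacent mP mQ P≡Q d (suc k) =
    alternatingWalk-adjacent mQ mP (sym P≡Q) (nextDart mP (⊆-reflexive P≡Q) d) k

  alternatingWalk-nonReturning : ∀ {P Q} mP mQ P≡Q (d : Dart P Q) k →
    alternatingWalk mP mQ P≡Q d (suc (suc k)) ≢ alternatingWalk mP mQ P≡Q d k
  alternatingWalk-nonReturning mP mQ P≡Q d zero    = nextDart-head≢tail mP (⊆-reflexive P≡Q) d
  alternatingWalk-nonReturning mP mQ P≡Q d (suc k) =
    alternatingWalk-nonReturning mQ mP (sym P≡Q) (nextDart mP (⊆-reflexive P≡Q) d) k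

  acyclic⇒covered-⊆ : ∀ {P Q} → Acyclic G → IsMatching P → IsMatching Q →
                      covered P ≡ covered Q → P ⊆ Q
  acyclic⇒covered-⊆ {P} {Q} acyclic mP mQ P≡Q {g} g∈P with g ∈? Q
  ... | yes g∈Q = g∈Q
  ... | no  g∉Q = ⊥-elim (acyclic (nonBacktrackingWalk⇒cycle
          (alternatingWalk-adjacent mP mQ P≡Q dart , alternatingWalk-nonReturning mP mQ P≡Q dart)))
    where
    dart : Dart P Q
    dart = record { tail = src g ; head = tgt g ; edge = g ; joins = inj₁ (refl , refl)
                  ; ∈P = g∈P ; ∉Q = g∉Q }

  acyclic⇒covered-injective : ∀ {P Q} → Acyclic G → IsMatching P → IsMatching Q →
                              covered P ≡ covered Q → P ≡ Q
  acyclic⇒covered-injective acyclic mP mQ P≡Q =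
    ⊆-antisym (acyclic⇒covered-⊆ acyclic mP mQ P≡Q) (acyclic⇒covered-⊆ acyclic mQ mP (sym P≡Q))

  evMatching⇒pairedDominating : ∀ {M} → EdgeVertexDominating G M → IsMatching M →
                                PairedDominating G (covered M)
  evMatching⇒pairedDominating {M} ev matching =
    dominating , M , (λ e e∈M → ∈-covered⁺ e∈M (inj₁ refl) , ∈-covered⁺ e∈M (inj₂ refl)) ,
    (λ v → ∈-covered⁻) , matching
    where
    dominating : Dominating G (covered M)
    dominating v v∉ with ev v
    ... | e , e∈M , inj₁ e∋v             = ⊥-elim (v∉ (∈-covered⁺ e∈M e∋v))
    ... | e , e∈M , inj₂ (u , e∋u , u~v) = u , ∈-covered⁺ e∈M e∋u , u~v

  pairedDominating⇒evMatching : ∀ {D M} → Dominating G D → PerfectMatchingOf G D M →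
    EdgeVertexDominating G M × IsMatching M × covered M ≡ D
  pairedDominating⇒evMatching {D} {M} dominating (ends∈D , saturated , matching) =
    ev , matching , ⊆-antisym covered⊆D D⊆covered
    where
    ev : EdgeVertexDominating G M
    ev v with v ∈? D
    ... | yes v∈D = let e , e∈M , e∋v = saturated v v∈D in e , e∈M , inj₁ e∋v
    ... | no  v∉D = let u , u∈D , u~v = dominating v v∉D
                        e , e∈M , e∋u = saturated u u∈D in e , e∈M , inj₂ (u , e∋u , u~v)
    covered⊆D : covered M ⊆ D
    covered⊆D v∈ with ∈-covered⁻ v∈
    ... | e , e∈M , inj₁ refl = proj₁ (ends∈D e e∈M)
    ... | e , e∈M , inj₂ refl = proj₂ (ends∈D e e∈M)
    D⊆covered : D ⊆ covered M
    D⊆covered v∈D = let e , e∈M , e∋v = saturated _ v∈D in ∈-covered⁺ e∈M e∋v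

  ∣D∣≡2*∣M∣ : ∀ {D M} → Dominating G D → PerfectMatchingOf G D M → ∣ D ∣ ≡ 2 * ∣ M ∣
  ∣D∣≡2*∣M∣ dominating pm =
    let _ , matching , M≡D = pairedDominating⇒evMatching dominating pm in
    trans (cong ∣_∣ (sym M≡D)) (∣covered∣≡2*∣M∣ matching)

  minEV⇒minEVMatching : ∀ {K P} → MinEdgeVertexDominating G K → IsMatching P → P ⊆ K →
    ∃ λ N → MinEdgeVertexDominating G N × IsMatching N × P ⊆ N
  minEV⇒minEVMatching (ev , minimal) matchingP P⊆K =
    let N , evN , matchingN , ∣N∣≤∣K∣ , P⊆N = evDominating⇒matching ev matchingP P⊆K in
    N , (evN , λ M evM → ≤-trans ∣N∣≤∣K∣ (minimal M evM)) , matchingN , P⊆N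

  minEVMatching⇒minPD : ∀ {N} → MinEdgeVertexDominating G N → IsMatching N →
                        MinPairedDominating G (covered N)
  minEVMatching⇒minPD {N} (ev , minimal) matching =
    evMatching⇒pairedDominating ev matching , λ D (dominating , M , pm) → begin
      ∣ covered N ∣  ≡⟨ ∣covered∣≡2*∣M∣ matching ⟩
      2 * ∣ N ∣      ≤⟨ *-monoʳ-≤ 2 (minimal M (proj₁ (pairedDominating⇒evMatching dominating pm))) ⟩
      2 * ∣ M ∣      ≡⟨ sym (∣D∣≡2*∣M∣ dominating pm) ⟩
      ∣ D ∣          ∎
    where open ≤-Reasoning

  minPD⇒minEV : ∀ {D M} → MinPairedDominating G D → PerfectMatchingOf G D M →
                MinEdgeVertexDominating G M
  minPD⇒minEV {D} {M} ((dominating , _) , minimal) pm =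
    proj₁ (pairedDominating⇒evMatching dominating pm) , λ M′ evM′ →
    let N , evN , matchingN , ∣N∣≤∣M′∣ , _ = evDominating⇒matching evM′ matching-⊥ (⊆-min M′) in
    *-cancelˡ-≤ 2 (begin
      2 * ∣ M ∣      ≡⟨ sym (∣D∣≡2*∣M∣ dominating pm) ⟩
      ∣ D ∣          ≤⟨ minimal _ (evMatching⇒pairedDominating evN matchingN) ⟩
      ∣ covered N ∣  ≡⟨ ∣covered∣≡2*∣M∣ matchingN ⟩
      2 * ∣ N ∣      ≤⟨ *-monoʳ-≤ 2 ∣N∣≤∣M′∣ ⟩
      2 * ∣ M′ ∣     ∎)
    where open ≤-Reasoning

  uniqueMinEV⇒uniqueMinPD : UniqueMinEdgeVertexDominating G → UniqueMinPairedDominating G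
  uniqueMinEV⇒uniqueMinPD (M₀ , minM₀ , unique) = covered M₀ , minPD , uniquePD
    where
    matchingM₀ : IsMatching M₀
    matchingM₀ = let N , minN , matchingN , _ = minEV⇒minEVMatching minM₀ matching-⊥ (⊆-min M₀) in
                 subst IsMatching (unique N minN) matchingN
    minPD : MinPairedDominating G (covered M₀)
    minPD = minEVMatching⇒minPD minM₀ matchingM₀
    uniquePD : ∀ D → MinPairedDominating G D → D ≡ covered M₀
    uniquePD D minD@((dominating , M , pm) , _) =
      let _ , _ , M≡D = pairedDominating⇒evMatching dominating pm in
      trans (sym M≡D) (cong covered (unique M (minPD⇒minEV minD pm)))

  uniqueMinPD⇒uniqueMinEV : Acyclic G → UniqueMinPairedDominating G → UniqueMinEdgeVertexDominating G
  uniqueMinPD⇒uniqueMinEV acyclic (D₀ , minD₀@((dominating₀ , M₀ , pm₀) , _) , unique) =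
    M₀ , minPD⇒minEV minD₀ pm₀ , uniqueEV
    where
    matchingM₀ : IsMatching M₀
    matchingM₀ = proj₁ (proj₂ (pairedDominating⇒evMatching dominating₀ pm₀))
    M₀≡D₀ : covered M₀ ≡ D₀
    M₀≡D₀ = proj₂ (proj₂ (pairedDominating⇒evMatching dominating₀ pm₀))
    minMatching≡M₀ : ∀ {N} → MinEdgeVertexDominating G N → IsMatching N → N ≡ M₀
    minMatching≡M₀ {N} minN matchingN = acyclic⇒covered-injective acyclic matchingN matchingM₀
      (trans (unique (covered N) (minEVMatching⇒minPD minN matchingN)) (sym M₀≡D₀))
    uniqueEV : ∀ K → MinEdgeVertexDominating G K → K ≡ M₀
    uniqueEV K minK = minMatching≡M₀ minK (matching-⊆ K⊆M₀ matchingM₀)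
      where
      -- p survives the repair of K into a minimum matching, and that matching is M₀.
      K⊆M₀ : K ⊆ M₀
      K⊆M₀ {p} p∈K =
        let N , minN , matchingN , ⁅p⁆⊆N = minEV⇒minEVMatching minK (matching-⁅⁆ p) (x∈p⇒⁅x⁆⊆p p∈K) in
        subst (p ∈_) (minMatching≡M₀ minN matchingN) (⁅p⁆⊆N (x∈⁅x⁆ p))

theorem2 : (T : Graph) → IsTree T →
    UniqueMinEdgeVertexDominating T ⇔ UniqueMinPairedDominating T
theorem2 T (_ , _ , acyclic) = mk⇔ (uniqueMinEV⇒uniqueMinPD T) (uniqueMinPD⇒uniqueMinEV T acyclic)
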